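{- Let $w$ be a word and let $T$ be a longest run of consecutive locations $i,i+1,\ldots,j$ of $w$ with $s_i(w)=\cdots=s_j(w)=2$ such that for every $k$ with $i\le k<j$ the FS-double squares $SQ_k^2$ and $SQ_{k+1}^2$ are conjugates; let $|T|=j-i+1$. Then $\frac{|T|}{|w|}\le\frac17$.
   Context: A square is a word $uu$ with $u$ nonempty. A square $uu$ occurs at location $k$ of $w=a_1\cdots a_n$ if $a_k\cdots a_{k+2|u|-1}=uu$. $s_k(w)$ is the number of distinct squares occurring at location $k$ of $w$ but at no location $k'>k$; it is known that $s_k(w)\le2$. When $s_k(w)=2$ the longer of these two squares is denoted $SQ_k^2$ and called the FS-double square at location $k$. Words $u,v$ are conjugates if $u=st$ and $v=ts$ for some words $s,t$. -}

module Defs where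

open import Data.Nat using (ℕ; suc; _+_; _*_; _∸_; _≤_; _<_)
open import Data.List using (List; []; _++_; take; drop; length)
open import Data.Product using (Σ; ∃; _×_)
open import Data.Sum using (_⊎_)
open import Relation.Binary.PropositionalEquality using (_≡_; _≢_)
open import Relation.Nullary using (¬_)

-- Words over an arbitrary alphabet A are lists; locations are 0-indexed:
-- location k of w = a_0 ⋯ a_{n-1} refers to a_k.

OccursAt : {A : Set} → List A → ℕ → List A → Set
OccursAt w k x = take (length x) (drop k w) ≡ x

Square : {A : Set} → List A → Set
Square {A} x = Σ (List A) λ u → (u ≢ []) × (x ≡ u ++ u)

NewSquareAt : {A : Set} → List A → ℕ → List A → Set
NewSquareAt w k x =
  Square x × OccursAt w k x × (∀ k' → k < k' → ¬ OccursAt w k' x)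

-- s_k(w) = 2 and v is the FS-double square SQ_k^2 (the longer of the two):
-- the set of squares counted by s_k(w) is exactly {x, v} with |x| < |v|.
FSDouble : {A : Set} → List A → ℕ → List A → Set
FSDouble {A} w k v =
  Σ (List A) λ x →
    NewSquareAt w k x × NewSquareAt w k v × (length x < length v) ×
    (∀ z → NewSquareAt w k z → (z ≡ x) ⊎ (z ≡ v))

DoubleAt : {A : Set} → List A → ℕ → Set
DoubleAt {A} w k = Σ (List A) λ v → FSDouble w k v

Conjugate : {A : Set} → List A → List A → Set
Conjugate {A} u v = Σ (List A) λ s → Σ (List A) λ t → (u ≡ s ++ t) × (v ≡ t ++ s)

IsRun : {A : Set} → List A → ℕ → ℕ → Set
IsRun w i j =
  i ≤ j × j < length w ×
  (∀ k → i ≤ k → k ≤ j → DoubleAt w k) ×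
  (∀ k → i ≤ k → k < j → ∀ u v → FSDouble w k u → FSDouble w (suc k) v → Conjugate u v)

runLength : ℕ → ℕ → ℕ
runLength i j = suc (j ∸ i)

IsLongestRun : {A : Set} → List A → ℕ → ℕ → Set
IsLongestRun w i j =
  IsRun w i j × (∀ i' j' → IsRun w i' j' → runLength i' j' ≤ runLength i j)

-- All FS-double squares of the run are conjugate, so they share a half-length p and together
-- make the factor w[i, j + 2p) p-periodic. Let the shorter new square at location k have
-- half-length q = p − d. Having no later occurrence, it cannot be shifted by p inside that
-- factor, so k + 2q > j + p; and its tail w[k + q, k + q + p) is d-periodic. If d changed
-- between k and k + 1, the Fine–Wilf theorem on the overlapping tails would give a common
-- period of both d's on a window long enough to spread, by Fine–Wilf again, over the whole
-- factor, and the shorter square at k would reoccur at k + d. So q is constant along the run;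
-- the same argument on the tails at i and j forces d > j − i + 1, and then q > j − i + d gives
-- |w| ≥ j + 2p ≥ 7 (j − i + 1).

module Submission where

open import Defs
open import Data.Nat
  using (ℕ; zero; suc; _+_; _*_; _∸_; _≤_; _<_; _≤′_; ≤′-step; ≤′-refl; z≤n; s≤s; z<s; _≤?_; _<?_; >-nonZero)
open import Data.Nat.Properties
open import Algebra.Properties.CommutativeSemigroup +-commutativeSemigroup using (xy∙z≈xz∙y)
open import Data.Nat.Divisibility using (_∣_; divides; ∣-refl; ∣⇒≤; ∣m∸n∣n⇒∣m; ∣m+n∣m⇒∣n; 0∣⇒≡0)
open import Data.Nat.Induction using (<-wellFounded)
open import Data.Nat.Tactic.RingSolver using (solve-∀)
open import Data.List using (List; []; _∷_; _++_; take; drop; length)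
open import Data.List.Properties using (length-++; length-take; length-drop)
open import Data.Maybe using (Maybe; just; nothing)
open import Data.Product using (Σ-syntax; _×_; _,_; proj₁; proj₂)
open import Data.Sum using (inj₁; inj₂)
open import Data.Empty using (⊥-elim)
open import Function.Base using (_∘_)
open import Function.Bundles using (_⇔_; mk⇔; Equivalence)
open import Induction.WellFounded using (Acc; acc)
open import Relation.Binary.Definitions using (tri<; tri≈; tri>)
open import Relation.Binary.PropositionalEquality
open import Relation.Nullary using (¬_; yes; no; contradiction)

private
  variable
    a a′ b b′ c c′ e e′ h o P : ℕ

m<n∸o⇒m+o<n : ∀ {m n o} → m < n ∸ o → m + o < n
m<n∸o⇒m+o<n {m} {n} {o} m<n∸o with o ≤? n
... | yes o≤n = m≤o∸n⇒m+n≤o (suc m) o≤n m<n∸o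
... | no  o≰n = contradiction (subst (m <_) (m≤n⇒m∸n≡0 (<⇒≤ (≰⇒> o≰n))) m<n∸o) λ ()

m∣n⇒0<m : ∀ {m n} → m ∣ n → 0 < n → 0 < m
m∣n⇒0<m {zero}  m∣n 0<n = contradiction (0∣⇒≡0 m∣n) (>⇒≢ 0<n)
m∣n⇒0<m {suc m} _   _   = s≤s z≤n

m∣n⇒m≤n : ∀ {m n} → m ∣ n → 0 < n → m ≤ n
m∣n⇒m≤n m∣n 0<n = ∣⇒≤ ⦃ >-nonZero 0<n ⦄ m∣n

m+m<n+n⇒m<n : ∀ {m n} → m + m < n + n → m < n
m+m<n+n⇒m<n {m} {n} lt with m <? n
... | yes m<n = m<n
... | no  m≮n = contradiction lt (≤⇒≯ (+-mono-≤ (≮⇒≥ m≮n) (≮⇒≥ m≮n)))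

m+m≡n+n⇒m≡n : ∀ {m n} → m + m ≡ n + n → m ≡ n
m+m≡n+n⇒m≡n {m} {n} eq with <-cmp m n
... | tri< m<n _ _ = contradiction eq (<⇒≢ (+-mono-< m<n m<n))
... | tri≈ _ m≡n _ = m≡n
... | tri> _ _ n<m = contradiction eq (>⇒≢ (+-mono-< n<m n<m))

Periodic : {M : Set} → (ℕ → M) → ℕ → ℕ → ℕ → Set
Periodic f e a b = ∀ t → a ≤ t → t + e < b → f t ≡ f (t + e)

module _ {M : Set} {f : ℕ → M} where

  Periodic-mono : a ≤ a′ → b′ ≤ b → Periodic f e a b → Periodic f e a′ b′
  Periodic-mono a≤a′ b′≤b per t a′≤t t+e<b′ = per t (≤-trans a≤a′ a′≤t) (<-≤-trans t+e<b′ b′≤b)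

  Periodic-* : ∀ r → Periodic f e a b → Periodic f (r * e) a b
  Periodic-* zero    per t _   _  = cong f (sym (+-identityʳ t))
  Periodic-* {e} {b = b} (suc r) per t a≤t lt = begin
    f t                 ≡⟨ per t a≤t (≤-<-trans (+-monoʳ-≤ t (m≤m+n e (r * e))) lt) ⟩
    f (t + e)           ≡⟨ Periodic-* r per (t + e) (≤-trans a≤t (m≤m+n t e))
                                          (subst (_< b) (sym (+-assoc t e (r * e))) lt) ⟩
    f (t + e + r * e)   ≡⟨ cong f (+-assoc t e (r * e)) ⟩
    f (t + (e + r * e)) ∎
    where open ≡-Reasoning

  Periodic-∣ : h ∣ e → Periodic f h a b → Periodic f e a b
  Periodic-∣ (divides r refl) = Periodic-* r

  Periodic-∪ : a ≤ a′ → a′ + e ≤ b → Periodic f e a b → Periodic f e a′ b′ → Periodic f e a b′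
  Periodic-∪ {e = e} {b = b} a≤a′ a′+e≤b per per′ t a≤t t+e<b′ with t + e <? b
  ... | yes t+e<b = per t a≤t t+e<b
  ... | no  t+e≮b = per′ t (+-cancelʳ-≤ e _ t (≤-trans a′+e≤b (≮⇒≥ t+e≮b))) t+e<b′

  Periodic-∸ : e ≤ e′ → Periodic f e a b → Periodic f e′ a b → Periodic f (e′ ∸ e) a (b ∸ e)
  Periodic-∸ {e} {e′} {a} {b} e≤e′ per per′ t a≤t lt = begin
    f t                  ≡⟨ per′ t a≤t (subst (_< b) t+δ+e≡t+e′ t+δ+e<b) ⟩
    f (t + e′)           ≡⟨ cong f (sym t+δ+e≡t+e′) ⟩
    f (t + (e′ ∸ e) + e) ≡⟨ sym (per (t + (e′ ∸ e)) (≤-trans a≤t (m≤m+n t _)) t+δ+e<b) ⟩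
    f (t + (e′ ∸ e))     ∎
    where
    open ≡-Reasoning
    t+δ+e<b : t + (e′ ∸ e) + e < b
    t+δ+e<b = m<n∸o⇒m+o<n lt
    t+δ+e≡t+e′ : t + (e′ ∸ e) + e ≡ t + e′
    t+δ+e≡t+e′ = trans (+-assoc t _ e) (cong (t +_) (m∸n+n≡m e≤e′))

module _ (R : ℕ → Set) {P lo hi c : ℕ} (0<P : 0 < P) (lo≤c : lo ≤ c) (c+P≤hi : c + P ≤ hi)
         (shift : ∀ t → lo ≤ t → t + P < hi → R t ⇔ R (t + P))
         (block : ∀ t → c ≤ t → t < c + P → R t) where

  private
    above : ∀ t → Acc _<_ t → c ≤ t → t < hi → R t
    above t (acc rec) c≤t t<hi with t <? c + P
    ... | yes t<c+P = block t c≤t t<c+P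
    ... | no  t≮c+P with m≤n⇒∃[o]m+o≡n (≮⇒≥ t≮c+P)
    ...   | s , refl = subst R (xy∙z≈xz∙y c s P)
              (Equivalence.to (shift (c + s) (≤-trans lo≤c (m≤m+n c s))
                                     (subst (_< hi) (sym (xy∙z≈xz∙y c s P)) t<hi))
                (above (c + s) (rec (subst (c + s <_) (xy∙z≈xz∙y c s P) (m<m+n (c + s) 0<P)))
                       (m≤m+n c s) (≤-<-trans (+-monoʳ-≤ c (m≤n+m s P)) (subst (_< hi) (+-assoc c P s) t<hi))))

    below : ∀ n t → c ≤ n + t → lo ≤ t → t < hi → R t
    below n t c≤n+t lo≤t t<hi with c ≤? t
    ... | yes c≤t = above t (<-wellFounded t) c≤t t<hi
    below zero    t c≤t   _   _    | no c≰t = contradiction c≤t c≰t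
    below (suc n) t c≤n+t lo≤t t<hi | no c≰t =
      Equivalence.from (shift t lo≤t t+P<hi)
        (below n (t + P) (≤-trans c≤n+t (subst (suc (n + t) ≤_) (+-assoc n t P) (m<m+n (n + t) 0<P)))
               (≤-trans lo≤t (m≤m+n t P)) t+P<hi)
      where
      t+P<hi : t + P < hi
      t+P<hi = <-≤-trans (+-monoˡ-< P (≰⇒> c≰t)) c+P≤hi

  invariant-from-block : ∀ t → lo ≤ t → t < hi → R t
  invariant-from-block t = below c t (m≤m+n c t)

module _ {M : Set} {f : ℕ → M} where

  Periodic-block : 0 < P → h ∣ P → a ≤ c → c + P + h ≤ b → c + P + h ≤ suc c′ →
                   Periodic f P a b → Periodic f h c c′ → ∀ t → c ≤ t → t < c + P → f t ≡ f (t + h)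
  Periodic-block {h = zero} 0<P h∣P = contradiction (m∣n⇒0<m h∣P 0<P) λ ()
  Periodic-block 0<P (divides zero refl) = contradiction 0<P λ ()
  Periodic-block {h = suc h′} {a} {c} {b} {c′} 0<P (divides (suc r) refl) a≤c c+P+h≤b c+P+h≤1+c′ perP perh
                 t c≤t t<c+P
    with suc t <? c + (suc h′ + r * suc h′)
  ... | yes 1+t<c+P = perh t c≤t (≤-pred (≤-trans (+-monoˡ-≤ (suc h′) 1+t<c+P) c+P+h≤1+c′))
  -- The window misses the last position of the block; step back P − h, a multiple of h,
  -- inside the window and then forward P.
  ... | no  1+t≮c+P = begin
    f t                  ≡⟨ cong f t≡s+m ⟩
    f (s + m)            ≡⟨ sym (Periodic-* r perh s (m≤m+n c h′) (subst (_< c′) t≡s+m t<c′)) ⟩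
    f s                  ≡⟨ perP s (≤-trans a≤c (m≤m+n c h′)) (subst (_< b) (sym s+P≡t+h) t+h<b) ⟩
    f (s + (suc h′ + m)) ≡⟨ cong f s+P≡t+h ⟩
    f (t + suc h′)       ∎
    where
    open ≡-Reasoning
    s = c + h′
    m = r * suc h′
    1+t≡c+P : suc t ≡ c + (suc h′ + m)
    1+t≡c+P = ≤-antisym t<c+P (≮⇒≥ 1+t≮c+P)
    t≡s+m : t ≡ s + m
    t≡s+m = suc-injective (trans 1+t≡c+P (rearrange c h′ m))
      where
      rearrange : ∀ c h′ m → c + (suc h′ + m) ≡ suc (c + h′ + m)
      rearrange = solve-∀
    s+P≡t+h : s + (suc h′ + m) ≡ t + suc h′
    s+P≡t+h = trans (rearrange c h′ m) (cong (_+ suc h′) (sym t≡s+m))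
      where
      rearrange : ∀ c h′ m → c + h′ + (suc h′ + m) ≡ c + h′ + m + suc h′
      rearrange = solve-∀
    t+h<b : t + suc h′ < b
    t+h<b = subst (_≤ b) (cong (_+ suc h′) (sym 1+t≡c+P)) c+P+h≤b
    t<c′ : t < c′
    t<c′ = <-≤-trans (m<m+n t z<s) (≤-pred (subst (_≤ suc c′) (cong (_+ suc h′) (sym 1+t≡c+P)) c+P+h≤1+c′))

  Periodic-extend : 0 < P → h ∣ P → a ≤ c → c + P + h ≤ b → c + P + h ≤ suc c′ →
                    Periodic f P a b → Periodic f h c c′ → Periodic f h a b
  Periodic-extend {P} {h} {a} {c} {b} 0<P h∣P a≤c c+P+h≤b c+P+h≤1+c′ perP perh t a≤t t+h<b =
    invariant-from-block (λ t → f t ≡ f (t + h)) 0<P a≤c (m+n≤o⇒m≤o∸n (c + P) c+P+h≤b) shift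
      (Periodic-block 0<P h∣P a≤c c+P+h≤b c+P+h≤1+c′ perP perh) t a≤t (m+n≤o⇒m≤o∸n (suc t) t+h<b)
    where
    shift : ∀ t → a ≤ t → t + P < b ∸ h → (f t ≡ f (t + h)) ⇔ (f (t + P) ≡ f (t + P + h))
    shift t a≤t lt = mk⇔ (λ eq → trans (sym shift-t) (trans eq shift-t+h))
                         (λ eq → trans shift-t (trans eq (sym shift-t+h)))
      where
      t+P+h<b : t + P + h < b
      t+P+h<b = m<n∸o⇒m+o<n lt
      shift-t : f t ≡ f (t + P)
      shift-t = perP t a≤t (≤-<-trans (m≤m+n (t + P) h) t+P+h<b)
      shift-t+h : f (t + h) ≡ f (t + P + h)
      shift-t+h = trans (perP (t + h) (≤-trans a≤t (m≤m+n t h)) (subst (_< b) (xy∙z≈xz∙y t P h) t+P+h<b))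
                        (cong f (xy∙z≈xz∙y t h P))

CommonPeriod : {M : Set} → (ℕ → M) → ℕ → ℕ → ℕ → ℕ → Set
CommonPeriod f e e′ a b = Σ[ h ∈ ℕ ] h ∣ e × h ∣ e′ × Periodic f h a b

private
  +-∸-cancel : e ≤ e′ → a + e + (e′ ∸ e) ≡ a + e′
  +-∸-cancel {e} {e′} {a} e≤e′ = trans (+-assoc a e _) (cong (a +_) (m+[n∸m]≡n e≤e′))

  fine-wilf-bound : e ≤ e′ → a + e + e′ ≤ suc b → a + e + (e′ ∸ e) ≤ suc (b ∸ e)
  fine-wilf-bound {e} {e′} {a} {b} e≤e′ bound = begin
    a + e + (e′ ∸ e) ≡⟨ +-∸-cancel e≤e′ ⟩
    a + e′           ≤⟨ m+n≤o⇒m≤o∸n (a + e′) (subst (_≤ suc b) (xy∙z≈xz∙y a e e′) bound) ⟩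
    suc b ∸ e        ≤⟨ m≤n+o⇒m∸n≤o (suc b) e
                          (subst (suc b ≤_) (sym (+-suc e (b ∸ e))) (s≤s (m≤n+m∸n b e))) ⟩
    suc (b ∸ e)      ∎
    where open ≤-Reasoning

module _ {M : Set} {f : ℕ → M} where

  CommonPeriod-swap : CommonPeriod f e e′ a b → CommonPeriod f e′ e a b
  CommonPeriod-swap (h , h∣e , h∣e′ , per) = h , h∣e′ , h∣e , per

  CommonPeriod-∸ : 0 < e → e < e′ → a + e + e′ ≤ suc b → Periodic f e a b →
                   CommonPeriod f e (e′ ∸ e) a (b ∸ e) → CommonPeriod f e e′ a b
  CommonPeriod-∸ {e} {e′} {a} {b} 0<e e<e′ bound per (h , h∣e , h∣e′∸e , perh) =
    h , h∣e , ∣m∸n∣n⇒∣m h (<⇒≤ e<e′) h∣e′∸e h∣e ,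
    Periodic-extend 0<e h∣e ≤-refl a+e+h≤b a+e+h≤1+b∸e per perh
    where
    a+e+h≤a+e+[e′∸e] : a + e + h ≤ a + e + (e′ ∸ e)
    a+e+h≤a+e+[e′∸e] = +-monoʳ-≤ (a + e) (m∣n⇒m≤n h∣e′∸e (m<n⇒0<n∸m e<e′))
    a+e+h≤1+b∸e : a + e + h ≤ suc (b ∸ e)
    a+e+h≤1+b∸e = ≤-trans a+e+h≤a+e+[e′∸e] (fine-wilf-bound (<⇒≤ e<e′) bound)
    a+e′<a+e+e′ : a + e′ < a + e + e′
    a+e′<a+e+e′ = subst (a + e′ <_) (xy∙z≈xz∙y a e′ e) (m<m+n (a + e′) 0<e)
    a+e+h≤b : a + e + h ≤ b
    a+e+h≤b = ≤-trans a+e+h≤a+e+[e′∸e]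
                (subst (_≤ b) (sym (+-∸-cancel (<⇒≤ e<e′))) (≤-pred (<-≤-trans a+e′<a+e+e′ bound)))

  fine-wilf : 0 < e → 0 < e′ → a + e + e′ ≤ suc b →
              Periodic f e a b → Periodic f e′ a b → CommonPeriod f e e′ a b
  fine-wilf = go (<-wellFounded _)
    where
    go : Acc _<_ (e + e′) → 0 < e → 0 < e′ → a + e + e′ ≤ suc b →
         Periodic f e a b → Periodic f e′ a b → CommonPeriod f e e′ a b
    go {e} {e′} {a} {b} (acc rec) 0<e 0<e′ bound per per′ with <-cmp e e′
    ... | tri≈ _ refl _ = e , ∣-refl , ∣-refl , per
    ... | tri< e<e′ _ _ =
      CommonPeriod-∸ 0<e e<e′ bound per
        (go (rec (subst (_< e + e′) (sym (m+[n∸m]≡n (<⇒≤ e<e′))) (m<n+m e′ 0<e)))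
            0<e (m<n⇒0<n∸m e<e′) (fine-wilf-bound (<⇒≤ e<e′) bound)
            (Periodic-mono ≤-refl (m∸n≤m b e) per) (Periodic-∸ (<⇒≤ e<e′) per per′))
    ... | tri> _ _ e′<e =
      CommonPeriod-swap (CommonPeriod-∸ 0<e′ e′<e bound′ per′
        (go (rec (subst (_< e + e′) (sym (m+[n∸m]≡n (<⇒≤ e′<e))) (m<m+n e 0<e′)))
            0<e′ (m<n⇒0<n∸m e′<e) (fine-wilf-bound (<⇒≤ e′<e) bound′)
            (Periodic-mono ≤-refl (m∸n≤m b e′) per′) (Periodic-∸ (<⇒≤ e′<e) per′ per)))
      where
      bound′ : a + e′ + e ≤ suc b
      bound′ = subst (_≤ suc b) (xy∙z≈xz∙y a e e′) bound

  Periodic-spread : 0 < P → 0 < e → a ≤ c → c′ < b → c + P + e ≤ suc c′ →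
                    Periodic f P a b → Periodic f e c c′ → Periodic f e a b
  Periodic-spread {P} {e} {a} {c} {c′} {b} 0<P 0<e a≤c c′<b bound perP pere =
    extend (fine-wilf 0<e 0<P (subst (_≤ suc c′) (xy∙z≈xz∙y c P e) bound)
                      pere (Periodic-mono a≤c (<⇒≤ c′<b) perP))
    where
    extend : CommonPeriod f e P c c′ → Periodic f e a b
    extend (h , h∣e , h∣P , perh) =
      Periodic-∣ h∣e (Periodic-extend 0<P h∣P a≤c (≤-trans c+P+h≤1+c′ c′<b) c+P+h≤1+c′ perP perh)
      where
      c+P+h≤1+c′ : c + P + h ≤ suc c′
      c+P+h≤1+c′ = ≤-trans (+-monoʳ-≤ (c + P) (m∣n⇒m≤n h∣e 0<e)) bound

  Periodic-overlap : 0 < e → 0 < e′ → o + e + e′ ≤ P →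
                     Periodic f e a (a + P) → Periodic f e′ (a + o) (a + o + P) →
                     CommonPeriod f e e′ a (a + o + P)
  Periodic-overlap {e} {e′} {o} {P} {a} 0<e 0<e′ bound per per′ =
    widen (fine-wilf 0<e 0<e′ (≤-trans a+o+e+e′≤a+P (n≤1+n _))
                     (Periodic-mono (m≤m+n a o) ≤-refl per) (Periodic-mono ≤-refl a+P≤a+o+P per′))
    where
    open ≤-Reasoning
    a+o+e+e′≤a+P : a + o + e + e′ ≤ a + P
    a+o+e+e′≤a+P = subst (_≤ a + P) (rearrange a o e e′) (+-monoʳ-≤ a bound)
      where
      rearrange : ∀ a o e e′ → a + (o + e + e′) ≡ a + o + e + e′
      rearrange = solve-∀
    a+P≤a+o+P : a + P ≤ a + o + P
    a+P≤a+o+P = +-monoˡ-≤ P (m≤m+n a o)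
    widen : CommonPeriod f e e′ (a + o) (a + P) → CommonPeriod f e e′ a (a + o + P)
    widen (h , h∣e , h∣e′ , perh) = h , h∣e , h∣e′ , Periodic-∪ (m≤m+n a o) a+o+h≤a+P left right
      where
      h≤e = m∣n⇒m≤n h∣e 0<e
      h≤e′ = m∣n⇒m≤n h∣e′ 0<e′
      a+o+e+h≤a+P : a + o + e + h ≤ a + P
      a+o+e+h≤a+P = ≤-trans (+-monoʳ-≤ (a + o + e) h≤e′) a+o+e+e′≤a+P
      a+o+e′+h≤a+P : a + o + e′ + h ≤ a + P
      a+o+e′+h≤a+P = begin
        a + o + e′ + h ≤⟨ +-monoʳ-≤ (a + o + e′) h≤e ⟩
        a + o + e′ + e ≡⟨ xy∙z≈xz∙y (a + o) e′ e ⟩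
        a + o + e + e′ ≤⟨ a+o+e+e′≤a+P ⟩
        a + P          ∎
      a+o+h≤a+P : a + o + h ≤ a + P
      a+o+h≤a+P = ≤-trans (+-monoʳ-≤ (a + o) (≤-trans h≤e (m≤m+n e e′)))
                    (subst (_≤ a + P) (+-assoc (a + o) e e′) a+o+e+e′≤a+P)
      left : Periodic f h a (a + P)
      left = Periodic-extend 0<e h∣e (m≤m+n a o) a+o+e+h≤a+P (≤-trans a+o+e+h≤a+P (n≤1+n _)) per perh
      right : Periodic f h (a + o) (a + o + P)
      right = Periodic-extend 0<e′ h∣e′ ≤-refl (≤-trans a+o+e′+h≤a+P a+P≤a+o+P)
                (≤-trans a+o+e′+h≤a+P (n≤1+n _)) per′ perh

-- The square other than SQ_k^2 counted by s_k, when SQ_k^2 has half-length p.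
record ShorterSquare {M : Set} (f : ℕ → M) (p k : ℕ) : Set where
  field
    q d           : ℕ
    0<d           : 0 < d
    p≡q+d         : p ≡ q + d
    square        : Periodic f q k (k + q + q)
    no-later-copy : ∀ k′ → k < k′ → ¬ (∀ t → t < q + q → f (k′ + t) ≡ f (k + t))

  q<p : q < p
  q<p = subst (q <_) (sym p≡q+d) (m<m+n q 0<d)

  0<p : 0 < p
  0<p = ≤-<-trans z≤n q<p

  not-d-periodic : ¬ Periodic f d k (k + q + q + d)
  not-d-periodic per = no-later-copy (k + d) (m<m+n k 0<d) λ t t<2q →
    trans (cong f (xy∙z≈xz∙y k d t))
          (sym (per (k + t) (m≤m+n k t) (+-monoˡ-< d (subst (k + t <_) (sym (+-assoc k q q)) (+-monoʳ-< k t<2q)))))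

private
  shifted-half : ∀ {q d q′ d′} δ → q + d ≡ q′ + d′ → suc d + δ ≡ d′ → q ≡ q′ + suc δ
  shifted-half {q} {d} {q′} δ q+d≡q′+d′ refl =
    +-cancelʳ-≡ d q (q′ + suc δ) (trans q+d≡q′+d′ (regroup q′ d δ))
    where
    regroup : ∀ q′ d δ → q′ + (suc d + δ) ≡ q′ + suc δ + d
    regroup = solve-∀

  window-grows : ∀ c P → h ≤ suc o → c + P + h ≤ suc (c + o + P)
  window-grows {h} {o} c P h≤1+o = ≤-trans (+-monoʳ-≤ (c + P) h≤1+o) (≤-reflexive (regroup c P o))
    where
    regroup : ∀ c p o → c + p + suc o ≡ suc (c + o + p)
    regroup = solve-∀

  run-length-≤ : ∀ {i j q d p} → i ≤ j → suc j < i + d → j + d < i + q → p ≡ q + d →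
                 7 * suc (j ∸ i) ≤ j + p + p
  run-length-≤ {i} {q = q} {d} i≤j 1+j<i+d j+d<i+q refl with m≤n⇒∃[o]m+o≡n i≤j
  ... | n , refl = begin
    7 * suc (i + n ∸ i)                            ≡⟨ cong (λ x → 7 * suc x) (m+n∸m≡n i n) ⟩
    7 * suc n                                      ≤⟨ m≤m+n (7 * suc n) 3 ⟩
    7 * suc n + 3                                  ≡⟨ expand n ⟩
    n + (suc (n + d₀) + d₀) + (suc (n + d₀) + d₀)  ≤⟨ twice-mono (+-mono-≤ (s≤s (+-monoʳ-≤ n d₀≤d)) d₀≤d) ⟩
    n + (suc (n + d) + d) + (suc (n + d) + d)      ≤⟨ twice-mono (+-monoˡ-≤ d 1+n+d≤q) ⟩
    n + (q + d) + (q + d)                          ≤⟨ twice-mono′ (m≤n+m n i) ⟩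
    i + n + (q + d) + (q + d)                      ∎
    where
    open ≤-Reasoning
    d₀ = suc (suc n)
    expand : ∀ n → 7 * suc n + 3 ≡ n + (suc (n + suc (suc n)) + suc (suc n)) + (suc (n + suc (suc n)) + suc (suc n))
    expand = solve-∀
    d₀≤d : d₀ ≤ d
    d₀≤d = +-cancelˡ-< i (suc n) d (subst (_< i + d) (sym (+-suc i n)) 1+j<i+d)
    1+n+d≤q : suc (n + d) ≤ q
    1+n+d≤q = +-cancelˡ-< i (n + d) q (subst (_< i + q) (+-assoc i n d) j+d<i+q)
    twice-mono : ∀ {x y} → x ≤ y → n + x + x ≤ n + y + y
    twice-mono x≤y = +-mono-≤ (+-monoʳ-≤ n x≤y) x≤y
    twice-mono′ : ∀ {x y} → x ≤ y → x + (q + d) + (q + d) ≤ y + (q + d) + (q + d)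
    twice-mono′ x≤y = +-monoˡ-≤ (q + d) (+-monoˡ-≤ (q + d) x≤y)

  common-divisor-≤ : ∀ {d d′} δ → suc d + δ ≡ d′ → h ∣ d → h ∣ d′ → h ≤ suc δ
  common-divisor-≤ {h} {d} δ refl h∣d h∣d′ =
    m∣n⇒m≤n (∣m+n∣m⇒∣n (subst (h ∣_) (sym (+-suc d δ)) h∣d′) h∣d) z<s

module _ {M : Set} {f : ℕ → M} {i j p : ℕ} (periodic : Periodic f p i (j + p + p)) where

  module _ {k} (i≤k : i ≤ k) (k≤j : k ≤ j) (s : ShorterSquare f p k) where
    open ShorterSquare s

    shorter-square-long : j + d < k + q
    shorter-square-long with j + d <? k + q
    ... | yes j+d<k+q = j+d<k+q
    ... | no  j+d≮k+q = contradiction copy-at-k+p (no-later-copy (k + p) (m<m+n k 0<p))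
      where
      k+q+q≤j+p : k + q + q ≤ j + p
      k+q+q≤j+p = subst (k + q + q ≤_) (trans (+-assoc j d q) (cong (j +_) (trans (+-comm d q) (sym p≡q+d))))
                    (+-monoˡ-≤ q (≮⇒≥ j+d≮k+q))
      copy-at-k+p : ∀ t → t < q + q → f (k + p + t) ≡ f (k + t)
      copy-at-k+p t t<2q =
        trans (cong f (xy∙z≈xz∙y k p t))
              (sym (periodic (k + t) (≤-trans i≤k (m≤m+n k t))
                     (+-monoˡ-< p (<-≤-trans (subst (k + t <_) (sym (+-assoc k q q)) (+-monoʳ-< k t<2q)) k+q+q≤j+p))))

    tail-ends-inside : k + q + p < j + p + p
    tail-ends-inside = +-monoˡ-< p (+-mono-≤-< k≤j q<p)

    tail-periodic : Periodic f d (k + q) (k + q + p)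
    tail-periodic t k+q≤t t+d<k+q+p with m≤n⇒∃[o]m+o≡n k+q≤t
    ... | s , refl = begin
      f (k + q + s)     ≡⟨ cong f (xy∙z≈xz∙y k q s) ⟩
      f (k + s + q)     ≡⟨ sym (square (k + s) (m≤m+n k s) (+-monoˡ-< q (+-monoʳ-< k s<q))) ⟩
      f (k + s)         ≡⟨ periodic (k + s) (≤-trans i≤k (m≤m+n k s))
                                    (+-monoˡ-< p (+-mono-≤-< k≤j (<-trans s<q q<p))) ⟩
      f (k + s + p)     ≡⟨ cong f (trans (cong (k + s +_) p≡q+d) (regroup k s q d)) ⟩
      f (k + q + s + d) ∎
      where
      open ≡-Reasoning
      regroup : ∀ k s q d → k + s + (q + d) ≡ k + q + s + d
      regroup = solve-∀
      s<q : s < q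
      s<q = +-cancelʳ-< d s q (+-cancelˡ-< (k + q) (s + d) (q + d)
              (subst₂ _<_ (+-assoc (k + q) s d) (cong (k + q +_) p≡q+d) t+d<k+q+p))

    -- Fine–Wilf with p would spread the window's period over the whole run, and then the
    -- shorter square at k would reoccur at k + d.
    no-periodic-window : h ∣ d → i ≤ c → c′ < j + p + p → c + p + h ≤ suc c′ → ¬ Periodic f h c c′
    no-periodic-window h∣d i≤c c′<b bound per =
      not-d-periodic (Periodic-mono i≤k k+q+q+d≤j+p+p
        (Periodic-∣ h∣d (Periodic-spread 0<p (m∣n⇒0<m h∣d 0<d) i≤c c′<b bound periodic per)))
      where
      k+q+q+d≤j+p+p : k + q + q + d ≤ j + p + p
      k+q+q+d≤j+p+p = subst (_≤ j + p + p) (trans (cong (k + q +_) p≡q+d) (sym (+-assoc (k + q) q d)))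
                        (<⇒≤ tail-ends-inside)

  module _ {k} (i≤k : i ≤ k) (1+k≤j : suc k ≤ j)
           (s : ShorterSquare f p k) (s′ : ShorterSquare f p (suc k)) where
    private
      module S  = ShorterSquare s
      module S′ = ShorterSquare s′
      k≤j : k ≤ j
      k≤j = ≤-trans (n≤1+n k) 1+k≤j
      i≤1+k : i ≤ suc k
      i≤1+k = ≤-trans i≤k (n≤1+n k)

    shorter-period-not-increasing : ∀ δ → suc S.d + δ ≢ S′.d
    shorter-period-not-increasing δ 1+d+δ≡d′ =
      refute (Periodic-overlap S′.0<d S.0<d δ+d′+d≤p (tail-periodic i≤1+k 1+k≤j s′)
                (subst (λ x → Periodic f S.d x (x + p)) (sym a+δ≡k+q) (tail-periodic i≤k k≤j s)))
      where
      a+δ≡k+q : suc k + S′.q + δ ≡ k + S.q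
      a+δ≡k+q = trans (regroup k S′.q δ)
                  (cong (k +_) (sym (shifted-half δ (trans (sym S.p≡q+d) S′.p≡q+d) 1+d+δ≡d′)))
        where
        regroup : ∀ k q′ δ → suc k + q′ + δ ≡ k + (q′ + suc δ)
        regroup = solve-∀
      d′<q′ : S′.d < S′.q
      d′<q′ = +-cancelˡ-< (suc k) S′.d S′.q
                (≤-<-trans (+-monoˡ-≤ S′.d 1+k≤j) (shorter-square-long i≤1+k 1+k≤j s′))
      δ+d′+d≤p : δ + S′.d + S.d ≤ p
      δ+d′+d≤p = begin
        δ + S′.d + S.d   ≡⟨ regroup δ S′.d S.d ⟩
        (S.d + δ) + S′.d ≤⟨ +-monoˡ-≤ S′.d (<⇒≤ (<-trans (subst (S.d + δ <_) 1+d+δ≡d′ ≤-refl) d′<q′)) ⟩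
        S′.q + S′.d      ≡⟨ sym S′.p≡q+d ⟩
        p                ∎
        where
        open ≤-Reasoning
        regroup : ∀ δ d′ d → δ + d′ + d ≡ d + δ + d′
        regroup = solve-∀
      refute : ¬ CommonPeriod f S′.d S.d (suc k + S′.q) (suc k + S′.q + δ + p)
      refute (h , h∣d′ , h∣d , per) =
        no-periodic-window i≤k k≤j s h∣d (≤-trans i≤1+k (m≤m+n (suc k) S′.q))
          (subst (λ x → x + p < j + p + p) (sym a+δ≡k+q) (tail-ends-inside i≤k k≤j s))
          (window-grows (suc k + S′.q) p (common-divisor-≤ δ 1+d+δ≡d′ h∣d h∣d′)) per

    shorter-period-not-decreasing : ∀ δ → suc S′.d + δ ≢ S.d
    shorter-period-not-decreasing δ 1+d′+δ≡d =
      refute (Periodic-overlap S.0<d S′.0<d o+d+d′≤p (tail-periodic i≤k k≤j s)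
                (subst (λ x → Periodic f S′.d x (x + p)) (sym a+o≡1+k+q′) (tail-periodic i≤1+k 1+k≤j s′)))
      where
      a+o≡1+k+q′ : k + S.q + suc (suc δ) ≡ suc k + S′.q
      a+o≡1+k+q′ = trans (regroup k S.q δ)
                     (cong (suc k +_) (sym (shifted-half δ (trans (sym S′.p≡q+d) S.p≡q+d) 1+d′+δ≡d)))
        where
        regroup : ∀ k q δ → k + q + suc (suc δ) ≡ suc k + (q + suc δ)
        regroup = solve-∀
      1+d<q : suc S.d < S.q
      1+d<q = +-cancelˡ-< k (suc S.d) S.q (≤-<-trans (subst (_≤ j + S.d) (sym (+-suc k S.d)) (+-monoˡ-≤ S.d 1+k≤j))
                                                    (shorter-square-long i≤k k≤j s))
      o+d+d′≤p : suc (suc δ) + S.d + S′.d ≤ p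
      o+d+d′≤p = begin
        suc (suc δ) + S.d + S′.d  ≡⟨ regroup δ S.d S′.d ⟩
        suc (suc S′.d + δ) + S.d  ≡⟨ cong (λ x → suc x + S.d) 1+d′+δ≡d ⟩
        suc S.d + S.d             ≤⟨ +-monoˡ-≤ S.d (<⇒≤ 1+d<q) ⟩
        S.q + S.d                 ≡⟨ sym S.p≡q+d ⟩
        p                         ∎
        where
        open ≤-Reasoning
        regroup : ∀ δ d d′ → suc (suc δ) + d + d′ ≡ suc (suc d′ + δ) + d
        regroup = solve-∀
      refute : ¬ CommonPeriod f S.d S′.d (k + S.q) (k + S.q + suc (suc δ) + p)
      refute (h , h∣d , h∣d′ , per) =
        no-periodic-window i≤k k≤j s h∣d (≤-trans i≤k (m≤m+n k S.q))
          (subst (λ x → x + p < j + p + p) (sym a+o≡1+k+q′) (tail-ends-inside i≤1+k 1+k≤j s′))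
          (window-grows (k + S.q) p (m≤n⇒m≤1+n (m≤n⇒m≤1+n (common-divisor-≤ δ 1+d′+δ≡d h∣d′ h∣d))))
          per

    shorter-squares-agree : S.q ≡ S′.q
    shorter-squares-agree with <-cmp S.d S′.d
    ... | tri< d<d′ _ _ = contradiction (proj₂ (m≤n⇒∃[o]m+o≡n d<d′)) (shorter-period-not-increasing _)
    ... | tri> _ _ d′<d = contradiction (proj₂ (m≤n⇒∃[o]m+o≡n d′<d)) (shorter-period-not-decreasing _)
    ... | tri≈ _ d≡d′ _ =
      +-cancelʳ-≡ S.d S.q S′.q (trans (sym S.p≡q+d) (trans S′.p≡q+d (cong (S′.q +_) (sym d≡d′))))

  shorter-period-exceeds-run : i ≤ j → (s₀ : ShorterSquare f p i) (s₁ : ShorterSquare f p j) →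
                               ShorterSquare.q s₀ ≡ ShorterSquare.q s₁ → suc j < i + ShorterSquare.d s₀
  shorter-period-exceeds-run i≤j s₀ s₁ q₀≡q₁ with suc j <? i + ShorterSquare.d s₀
  ... | yes 1+j<i+d = 1+j<i+d
  ... | no  1+j≮i+d = ⊥-elim (
    no-periodic-window ≤-refl i≤j s₀ ∣-refl (m≤m+n i q)
      (subst (λ x → j + x + p < j + p + p) (sym q₀≡q₁) (tail-ends-inside i≤j ≤-refl s₁))
      bound (Periodic-∪ (+-monoˡ-≤ q i≤j) tails-overlap (tail-periodic ≤-refl i≤j s₀) tail₁))
    where
    open ≤-Reasoning
    module S₀ = ShorterSquare s₀
    module S₁ = ShorterSquare s₁
    q = S₀.q
    d = S₀.d
    d₁≡d : S₁.d ≡ d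
    d₁≡d = +-cancelˡ-≡ q S₁.d d (trans (cong (_+ S₁.d) q₀≡q₁) (trans (sym S₁.p≡q+d) S₀.p≡q+d))
    tail₁ : Periodic f d (j + q) (j + q + p)
    tail₁ = subst₂ (λ x y → Periodic f y (j + x) (j + x + p)) (sym q₀≡q₁) d₁≡d (tail-periodic i≤j ≤-refl s₁)
    tails-overlap : j + q + d ≤ i + q + p
    tails-overlap = begin
      j + q + d ≡⟨ xy∙z≈xz∙y j q d ⟩
      j + d + q ≤⟨ +-monoˡ-≤ q (<⇒≤ (shorter-square-long ≤-refl i≤j s₀)) ⟩
      i + q + q ≤⟨ +-monoʳ-≤ (i + q) (<⇒≤ S₀.q<p) ⟩
      i + q + p ∎
    bound : i + q + p + d ≤ suc (j + q + p)
    bound = begin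
      i + q + p + d   ≡⟨ regroup i q p d ⟩
      i + d + (q + p) ≤⟨ +-monoˡ-≤ (q + p) (≮⇒≥ 1+j≮i+d) ⟩
      suc j + (q + p) ≡⟨ cong suc (sym (+-assoc j q p)) ⟩
      suc (j + q + p) ∎
      where
      regroup : ∀ i q p d → i + q + p + d ≡ i + d + (q + p)
      regroup = solve-∀

  module _ (i≤j : i ≤ j) (shorter : ∀ k → i ≤ k → k ≤ j → ShorterSquare f p k) where

    shorter-half-constant : ∀ {k} (i≤′k : i ≤′ k) (k≤j : k ≤ j) →
      ShorterSquare.q (shorter k (≤′⇒≤ i≤′k) k≤j) ≡ ShorterSquare.q (shorter i ≤-refl i≤j)
    shorter-half-constant ≤′-refl k≤j =
      cong₂ (λ x y → ShorterSquare.q (shorter _ x y)) (≤-irrelevant _ _) (≤-irrelevant _ _)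
    shorter-half-constant {suc k} (≤′-step i≤′k) 1+k≤j =
      trans (sym (shorter-squares-agree (≤′⇒≤ i≤′k) 1+k≤j
                   (shorter k (≤′⇒≤ i≤′k) k≤j) (shorter (suc k) _ 1+k≤j)))
            (shorter-half-constant i≤′k k≤j)
      where
      k≤j = ≤-trans (n≤1+n k) 1+k≤j

    run-length-bound : 7 * suc (j ∸ i) ≤ j + p + p
    run-length-bound =
      run-length-≤ i≤j (shorter-period-exceeds-run i≤j s₀ s₁ (sym (shorter-half-constant (≤⇒≤′ i≤j) ≤-refl)))
        (shorter-square-long ≤-refl i≤j s₀) (ShorterSquare.p≡q+d s₀)
      where
      s₀ = shorter i ≤-refl i≤j
      s₁ = shorter j (≤′⇒≤ (≤⇒≤′ i≤j)) ≤-refl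

module _ {A : Set} where

  at : List A → ℕ → Maybe A
  at []       _       = nothing
  at (x ∷ xs) zero    = just x
  at (x ∷ xs) (suc t) = at xs t

  at-injective : ∀ (xs ys : List A) → (∀ t → at xs t ≡ at ys t) → xs ≡ ys
  at-injective []       []       _    = refl
  at-injective []       (y ∷ ys) same with () ← same 0
  at-injective (x ∷ xs) []       same with () ← same 0
  at-injective (x ∷ xs) (y ∷ ys) same with refl ← same 0 = cong (x ∷_) (at-injective xs ys (same ∘ suc))

  at-≥ : ∀ (xs : List A) t → length xs ≤ t → at xs t ≡ nothing
  at-≥ []       t       _         = refl
  at-≥ (x ∷ xs) (suc t) (s≤s len≤t) = at-≥ xs t len≤t

  at-take : ∀ (xs : List A) {L} t → t < L → at (take L xs) t ≡ at xs t
  at-take []       {suc L} t       _         = refl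
  at-take (x ∷ xs) {suc L} zero    _         = refl
  at-take (x ∷ xs) {suc L} (suc t) (s≤s t<L) = at-take xs t t<L

  at-take-≥ : ∀ (xs : List A) L t → L ≤ t → at (take L xs) t ≡ nothing
  at-take-≥ xs       zero    t       _         = refl
  at-take-≥ []       (suc L) t       _         = refl
  at-take-≥ (x ∷ xs) (suc L) (suc t) (s≤s L≤t) = at-take-≥ xs L t L≤t

  at-drop : ∀ (xs : List A) k t → at (drop k xs) t ≡ at xs (k + t)
  at-drop xs       zero    t = refl
  at-drop []       (suc k) t = refl
  at-drop (x ∷ xs) (suc k) t = at-drop xs k t

  at-++ˡ : ∀ (u v : List A) {t} → t < length u → at (u ++ v) t ≡ at u t
  at-++ˡ (x ∷ u) v {zero}  _         = refl
  at-++ˡ (x ∷ u) v {suc t} (s≤s t<u) = at-++ˡ u v t<u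

  at-++ʳ : ∀ (u v : List A) t → at (u ++ v) (length u + t) ≡ at v t
  at-++ʳ []      v t = refl
  at-++ʳ (x ∷ u) v t = at-++ʳ u v t

  length-pos : ∀ {xs : List A} → xs ≢ [] → 0 < length xs
  length-pos {[]}    xs≢[] = contradiction refl xs≢[]
  length-pos {x ∷ _} _     = z<s

  OccursAt-at : ∀ {w : List A} {k x} → OccursAt w k x → ∀ {t} → t < length x → at w (k + t) ≡ at x t
  OccursAt-at {w} {k} {x} occ {t} t<x = begin
    at w (k + t)                      ≡⟨ sym (at-drop w k t) ⟩
    at (drop k w) t                   ≡⟨ sym (at-take (drop k w) t t<x) ⟩
    at (take (length x) (drop k w)) t ≡⟨ cong (λ y → at y t) occ ⟩
    at x t                            ∎
    where open ≡-Reasoning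

  at-OccursAt : ∀ {w : List A} {k x} → (∀ t → t < length x → at w (k + t) ≡ at x t) → OccursAt w k x
  at-OccursAt {w} {k} {x} same = at-injective _ x letter
    where
    letter : ∀ t → at (take (length x) (drop k w)) t ≡ at x t
    letter t with t <? length x
    ... | yes t<x = trans (at-take (drop k w) t t<x) (trans (at-drop w k t) (same t t<x))
    ... | no  t≮x = trans (at-take-≥ (drop k w) (length x) t (≮⇒≥ t≮x)) (sym (at-≥ x t (≮⇒≥ t≮x)))

  OccursAt-fits : ∀ {w : List A} {k x} → OccursAt w k x → 0 < length x → k + length x ≤ length w
  OccursAt-fits {w} {k} {x} occ 0<x =
    subst (_≤ length w) (+-comm (length x) k) (m≤o∸n⇒m+n≤o (length x) k≤w x≤w∸k)
    where
    x≤w∸k : length x ≤ length w ∸ k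
    x≤w∸k = subst₂ _≤_ (cong length occ) (length-drop k w)
              (subst (_≤ length (drop k w)) (sym (length-take (length x) (drop k w))) (m⊓n≤n _ _))
    k≤w : k ≤ length w
    k≤w = <⇒≤ (m∸n≢0⇒n<m (>⇒≢ (<-≤-trans 0<x x≤w∸k)))

  OccursAt-copy : ∀ {w : List A} {k k′ x} → OccursAt w k x →
                  (∀ t → t < length x → at w (k′ + t) ≡ at w (k + t)) → OccursAt w k′ x
  OccursAt-copy {w} {k} {k′} occ same =
    at-OccursAt {w} {k′} λ t t<x → trans (same t t<x) (OccursAt-at {w} {k} occ t<x)

  square-periodic : ∀ {w : List A} {k u} → OccursAt w k (u ++ u) →
                    Periodic (at w) (length u) k (k + length u + length u)
  square-periodic {w} {k} {u} occ t k≤t t+u<end with m≤n⇒∃[o]m+o≡n k≤t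
  ... | s , refl = begin
    at w (k + s)               ≡⟨ OccursAt-at {w} {k} occ (in-square (<-≤-trans s<u (m≤m+n n n))) ⟩
    at (u ++ u) s              ≡⟨ at-++ˡ u u s<u ⟩
    at u s                     ≡⟨ sym (at-++ʳ u u s) ⟩
    at (u ++ u) (length u + s) ≡⟨ sym (OccursAt-at {w} {k} occ (in-square (+-monoʳ-< n s<u))) ⟩
    at w (k + (length u + s))  ≡⟨ cong (at w) (regroup k n s) ⟩
    at w (k + s + length u)    ∎
    where
    open ≡-Reasoning
    n = length u
    in-square : ∀ {x} → x < n + n → x < length (u ++ u)
    in-square = subst (_ <_) (sym (length-++ u))
    regroup : ∀ k n s → k + (n + s) ≡ k + s + n
    regroup = solve-∀
    s<u : s < n
    s<u = +-cancelʳ-< n s n (+-cancelˡ-< k (s + n) (n + n) (subst₂ _<_ (+-assoc k s n) (+-assoc k n n) t+u<end))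

  conjugate-length : ∀ {u v : List A} → Conjugate u v → length u ≡ length v
  conjugate-length (s , t , refl , refl) =
    trans (length-++ s) (trans (+-comm (length s) (length t)) (sym (length-++ t)))

  module _ {w : List A} {k : ℕ} where

    FSDouble-unique : ∀ {v v′} → FSDouble w k v → FSDouble w k v′ → v ≡ v′
    FSDouble-unique {v} {v′} (x , _ , new-v , x<v , only) (x′ , _ , new-v′ , x′<v′ , only′)
      with only v′ new-v′
    ... | inj₂ v′≡v = sym v′≡v
    ... | inj₁ v′≡x with only′ v new-v
    ...   | inj₂ v≡v′ = v≡v′
    ...   | inj₁ v≡x′ = contradiction
      (<-trans x<v (subst₂ _<_ (cong length (sym v≡x′)) (cong length v′≡x) x′<v′)) (<-irrefl refl)

    half-length : ∀ {v} → FSDouble w k v → ℕ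
    half-length (_ , _ , ((V , _) , _) , _) = length V

    FSDouble-length : ∀ {v} (W : FSDouble w k v) → length v ≡ half-length W + half-length W
    FSDouble-length (_ , _ , ((V , _ , refl) , _) , _) = length-++ V

    0<half-length : ∀ {v} (W : FSDouble w k v) → 0 < half-length W
    0<half-length (_ , _ , ((V , V≢[] , _) , _) , _) = length-pos V≢[]

    FSDouble-periodic : ∀ {p v} → FSDouble w k v → length v ≡ p + p → Periodic (at w) p k (k + p + p)
    FSDouble-periodic (_ , _ , ((V , _ , refl) , occ , _) , _) |v|≡p+p =
      subst (λ n → Periodic (at w) n k (k + n + n)) (m+m≡n+n⇒m≡n (trans (sym (length-++ V)) |v|≡p+p))
        (square-periodic {w} {k} {V} occ)

    FSDouble-shorter : ∀ {p v} → FSDouble w k v → length v ≡ p + p → ShorterSquare (at w) p k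
    FSDouble-shorter {p} (_ , ((u , _ , refl) , occ , later) , _ , x<v , _) |v|≡p+p = record
      { q             = length u
      ; d             = p ∸ length u
      ; 0<d           = m<n⇒0<n∸m q<p
      ; p≡q+d         = sym (m+[n∸m]≡n (<⇒≤ q<p))
      ; square        = square-periodic {w} {k} {u} occ
      ; no-later-copy = λ k′ k<k′ same →
          later k′ k<k′ (OccursAt-copy {w} {k} {k′} occ λ t t<x → same t (subst (t <_) (length-++ u) t<x))
      }
      where
      q<p : length u < p
      q<p = m+m<n+n⇒m<n (subst₂ _<_ (length-++ u) |v|≡p+p x<v)

    FSDouble-fits : ∀ {p v} → FSDouble w k v → length v ≡ p + p → k + p + p ≤ length w
    FSDouble-fits {p} (_ , _ , (_ , occ , _) , x<v , _) |v|≡p+p =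
      subst (_≤ length w) (trans (cong (k +_) |v|≡p+p) (sym (+-assoc k p p)))
        (OccursAt-fits {w} {k} occ (≤-<-trans z≤n x<v))

module _ {A : Set} {w : List A} {i j : ℕ} (run : IsRun w i j) where

  private
    i≤j = proj₁ run
    double = proj₁ (proj₂ (proj₂ run))
    conjugate = proj₂ (proj₂ (proj₂ run))
    W₀ = proj₂ (double i ≤-refl i≤j)

  run-half-length : ℕ
  run-half-length = half-length W₀

  private
    p = run-half-length

    square-length : ∀ {k v} → i ≤′ k → k ≤ j → FSDouble w k v → length v ≡ p + p
    square-length ≤′-refl _ W = trans (cong length (FSDouble-unique W W₀)) (FSDouble-length W₀)
    square-length {suc k} (≤′-step i≤′k) 1+k≤j W =
      trans (sym (conjugate-length (conjugate k (≤′⇒≤ i≤′k) 1+k≤j _ _ (proj₂ previous) W)))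
            (square-length i≤′k k≤j (proj₂ previous))
      where
      k≤j = ≤-trans (n≤1+n k) 1+k≤j
      previous = double k (≤′⇒≤ i≤′k) k≤j

    long-square-periodic : ∀ {k} → i ≤ k → k ≤ j → Periodic (at w) p k (k + p + p)
    long-square-periodic i≤k k≤j = FSDouble-periodic W (square-length (≤⇒≤′ i≤k) k≤j W)
      where W = proj₂ (double _ i≤k k≤j)

    periodic-up-to : ∀ {k} → i ≤′ k → k ≤ j → Periodic (at w) p i (k + p + p)
    periodic-up-to ≤′-refl k≤j = long-square-periodic ≤-refl k≤j
    periodic-up-to {suc k} (≤′-step i≤′k) 1+k≤j =
      Periodic-∪ (≤′⇒≤ (≤′-step i≤′k)) (m<m+n (k + p) (0<half-length W₀))
        (periodic-up-to i≤′k (≤-trans (n≤1+n k) 1+k≤j))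
        (long-square-periodic (≤′⇒≤ (≤′-step i≤′k)) 1+k≤j)

  run-periodic : Periodic (at w) p i (j + p + p)
  run-periodic = periodic-up-to (≤⇒≤′ i≤j) ≤-refl

  run-shorter : ∀ k → i ≤ k → k ≤ j → ShorterSquare (at w) p k
  run-shorter k i≤k k≤j = FSDouble-shorter W (square-length (≤⇒≤′ i≤k) k≤j W)
    where W = proj₂ (double k i≤k k≤j)

  run-fits : j + p + p ≤ length w
  run-fits = FSDouble-fits W (square-length (≤⇒≤′ i≤j) ≤-refl W)
    where W = proj₂ (double j i≤j ≤-refl)

lemma15 : {A : Set} (w : List A) (i j : ℕ) →
    IsLongestRun w i j → 7 * runLength i j ≤ length w
lemma15 w i j (run , _) =
  ≤-trans (run-length-bound (run-periodic run) (proj₁ run) (run-shorter run)) (run-fits run)
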